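{- The following two statements are equivalent. (i) (Edmonds–Giles conjecture) For every digraph $D=(V,A)$ with arc weights $w\in\{0,1\}^A$ such that the minimum weight of a dicut is $\tau$, there exist $\tau$ dijoins $J_1,\dots,J_\tau$ of $D$ such that every arc $e$ lies in at most $w(e)$ of them. (ii) For every undirected graph $G=(V,E)$ and every integer $\tau>0$, every $\tau$-SCO $x$ of $G$ can be written as $x=\sum_{i=1}^{\tau}\chi_{O_i}$ where each $O_i$ is a strongly connected orientation of $G$.
   Context: In a digraph $D=(V,A)$, a dicut is an arc set $\delta^+_D(U)$ (arcs leaving $U$) with $\emptyset\neq U\subsetneq V$ and no arc of $D$ entering $U$; its weight is the sum of $w$ over its arcs. A dijoin is an arc set meeting every dicut. For an undirected graph $G=(V,E)$, let $\vec G=(V,E^+\cup E^-)$ be obtained by replacing each edge $e=\{u,v\}$ by two oppositely directed arcs $e^+=(u,v)$ and $e^-=(v,u)$. An orientation of $G$ is a set $O\subseteq E^+\cup E^-$ containing exactly one of $e^+,e^-$ for each $e\in E$; it is a strongly connected orientation (SCO) if for every $\emptyset\ne U\subsetneq V$ some arc of $O$ leaves $U$. $\chi_O\in\{0,1\}^{E^+\cup E^- }$ is the characteristic vector. A $\tau$-SCO of $G$ is an integer vector $x\in\mathbb{Z}^{E^+\cup E^- }$ with $x_{e^+},x_{e^- }\ge 0$ and $x_{e^+}+x_{e^- }=\tau$ for every $e\in E$, and $x(\delta^+_{\vec G}(U))\ge\tau$ for every $\emptyset\ne U\subsetneq V$, where $\delta^+_{\vec G}(U)$ is the set of arcs of $\vec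 G$ leaving $U$ and $x(F)=\sum_{a\in F}x_a$. -}

module Defs where

open import Data.Nat using (ℕ; zero; suc; _+_; _≤_; _<_)
open import Data.Fin using (Fin)
import Data.Fin as F
open import Data.Bool using (Bool; true; false; if_then_else_; _∧_; not)
open import Data.Product using (Σ; _×_; ∃; ∃-syntax; _,_)
open import Relation.Binary.PropositionalEquality using (_≡_)
open import Relation.Nullary using (¬_)

∑ : ∀ {m} → (Fin m → ℕ) → ℕ
∑ {zero}  f = 0
∑ {suc m} f = f F.zero + ∑ (λ i → f (F.suc i))

count : ∀ {k} → (Fin k → Bool) → ℕ
count p = ∑ (λ i → if p i then 1 else 0)

VSet : ℕ → Set
VSet n = Fin n → Bool

NonemptyProper : ∀ {n} → VSet n → Set
NonemptyProper {n} U = (∃[ v ] U v ≡ true) × (∃[ v ] U v ≡ false)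

leavesᵇ : ∀ {n} → VSet n → Fin n → Fin n → Bool
leavesᵇ U t h = U t ∧ not (U h)

-- Digraphs D = (V , A) with V = Fin n and A = Fin m (parallel arcs
-- allowed); arc a goes from tail a to head a.

record Digraph : Set where
  field
    n m  : ℕ
    tail : Fin m → Fin n
    head : Fin m → Fin n

module _ (D : Digraph) where
  open Digraph D

  Leaves : VSet n → Fin m → Set
  Leaves U a = leavesᵇ U (tail a) (head a) ≡ true

  -- U determines a dicut: ∅ ≠ U ⊊ V and no arc of D enters U
  -- (the dicut itself is the arc set δ⁺_D(U)).
  IsDicut : VSet n → Set
  IsDicut U = NonemptyProper U × (∀ a → ¬ (leavesᵇ U (head a) (tail a) ≡ true))

  dicutWeight : (Fin m → Bool) → VSet n → ℕ
  dicutWeight w U = ∑ (λ a → if leavesᵇ U (tail a) (head a) ∧ w a then 1 else 0)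

  MinDicutWeight : (Fin m → Bool) → ℕ → Set
  MinDicutWeight w τ =
    (∀ U → IsDicut U → τ ≤ dicutWeight w U) × (∃[ U ] (IsDicut U × dicutWeight w U ≡ τ))

  IsDijoin : (Fin m → Bool) → Set
  IsDijoin J = ∀ U → IsDicut U → ∃[ a ] (Leaves U a × J a ≡ true)

EdmondsGiles : Set
EdmondsGiles =
  (D : Digraph) (w : Fin (Digraph.m D) → Bool) (τ : ℕ) →
  MinDicutWeight D w τ →
  Σ (Fin τ → Fin (Digraph.m D) → Bool) λ J →
         ((∀ (i : Fin τ) → IsDijoin D (J i)) ×
          (∀ a → count (λ (i : Fin τ) → J i a) ≤ (if w a then 1 else 0)))

-- Undirected graphs G = (V , E), V = Fin n, E = Fin m (parallel edges
-- allowed); edge e has endpoints end₁ e , end₂ e.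
-- Arcs of G⃗ are pairs (e , d) : Fin m × Bool, with
--   (e , true)  = e⁺ = (end₁ e , end₂ e),
--   (e , false) = e⁻ = (end₂ e , end₁ e).

record Graph : Set where
  field
    n m  : ℕ
    end₁ : Fin m → Fin n
    end₂ : Fin m → Fin n

module _ (G : Graph) where
  open Graph G

  arcTail : Fin m → Bool → Fin n
  arcTail e true  = end₁ e
  arcTail e false = end₂ e

  arcHead : Fin m → Bool → Fin n
  arcHead e true  = end₂ e
  arcHead e false = end₁ e

  -- vectors indexed by E⁺ ∪ E⁻ (nonnegative integers as ℕ)
  ArcVec : Set
  ArcVec = Fin m → Bool → ℕ

  outSum : ArcVec → VSet n → ℕ
  outSum x U = ∑ (λ e →
      (if leavesᵇ U (arcTail e true)  (arcHead e true)  then x e true  else 0)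
    + (if leavesᵇ U (arcTail e false) (arcHead e false) then x e false else 0))

  IsτSCO : ℕ → ArcVec → Set
  IsτSCO τ x = (∀ e → x e true + x e false ≡ τ) ×
               (∀ U → NonemptyProper U → τ ≤ outSum x U)

  -- An orientation O picks, for each edge e, exactly one of e⁺ (o e = true)
  -- and e⁻ (o e = false).
  Orientation : Set
  Orientation = Fin m → Bool

  InO : Orientation → Fin m → Bool → Bool
  InO o e true  = o e
  InO o e false = not (o e)

  χ : Orientation → ArcVec
  χ o e d = if InO o e d then 1 else 0

  IsSCO : Orientation → Set
  IsSCO o = ∀ U → NonemptyProper U →
    ∃[ e ] ∃[ d ] (InO o e d ≡ true × leavesᵇ U (arcTail e d) (arcHead e d) ≡ true)

SCODecomposition : Set
SCODecomposition =
  (G : Graph) (τ : ℕ) → 0 < τ → (x : ArcVec G) → IsτSCO G τ x →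
  Σ (Fin τ → Orientation G) λ O →
         ((∀ (i : Fin τ) → IsSCO G (O i)) ×
          (∀ e d → x e d ≡ ∑ (λ (i : Fin τ) → χ G (O i) e d)))

-- (ii) ⇒ (i): replace every arc a of D by two edges carrying x = (w a , τ − w a) and
-- x = (0 , τ).  This x is a τ-SCO: a set entered by some arc is left by the second copy of
-- that arc with value τ, and a dicut is left by first copies of total value at least its
-- weight.  In a decomposition into τ SCOs, the weight-1 arcs whose first copy the i-th SCO
-- uses forwards form a dijoin, and every weight-1 arc lies in exactly one of them.
--
-- (i) ⇒ (ii): put a node on every edge e, with two weight-0 arcs from it to the ends of e and
-- τ weight-1 arcs, x(e⁺) of them to the head of e⁺ and the rest to the head of e⁻.  Every
-- dicut has weight ≥ τ and the star of a node has weight τ, so (i) gives τ disjoint dijoins,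
-- each containing exactly one weight-1 arc at every node.  Orienting each e towards the head
-- of the arc chosen by the i-th dijoin gives an SCO, since the i-th dijoin must cross the
-- dicut formed by a vertex set U together with the nodes of the edges meeting U.

module Submission where

open import Defs
open import Function.Base using (_∘_; id)
open import Function.Bundles using (_⇔_; mk⇔)
open import Data.Nat using (ℕ; zero; suc; _+_; _*_; _≤_; _<ᵇ_; z≤n; s≤s)
open import Data.Nat.Properties
open import Data.Fin using (Fin; zero; suc; toℕ; _↑ˡ_; _↑ʳ_; splitAt; combine; remQuot)
import Data.Fin.Properties as Fin
open import Data.Bool using (Bool; true; false; if_then_else_; _∧_; _∨_; not)
open import Data.Bool.Properties using (∨-zeroʳ; ∧-identityʳ; ∧-zeroʳ; ¬-not) renaming (_≟_ to _≟ᵇ_)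
open import Data.Vec.Functional using (foldr)
open import Data.Sum using (inj₁; inj₂; [_,_]′)
open import Data.Product using (Σ; _×_; ∃-syntax; _,_; proj₁; proj₂; uncurry)
open import Data.Empty using (⊥-elim)
open import Relation.Binary.PropositionalEquality hiding ([_]; J)
open import Relation.Nullary using (¬_; yes; no; does)
open import Relation.Nullary.Decidable using (dec-true; dec-false)
import Algebra.Properties.CommutativeMonoid.Sum +-0-commutativeMonoid as ℕ-Sum

[_] : Bool → ℕ
[ b ] = if b then 1 else 0

∧≡true⇒ˡ : ∀ a {b} → a ∧ b ≡ true → a ≡ true
∧≡true⇒ˡ true _ = refl

≟⇒≡ : ∀ {k} (i j : Fin k) → does (i Fin.≟ j) ≡ true → i ≡ j
≟⇒≡ i j eq with i Fin.≟ j
... | yes i≡j = i≡j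
≟⇒≡ i j () | no _

∑≡sum : ∀ {k} (f : Fin k → ℕ) → ∑ f ≡ ℕ-Sum.sum f
∑≡sum {zero}  f = refl
∑≡sum {suc k} f = cong (f zero +_) (∑≡sum (f ∘ suc))

∑-cong : ∀ {k} {f g : Fin k → ℕ} → f ≗ g → ∑ f ≡ ∑ g
∑-cong {f = f} {g} f≗g = trans (∑≡sum f) (trans (ℕ-Sum.sum-cong-≗ f≗g) (sym (∑≡sum g)))

∑-zero : ∀ k → ∑ {k} (λ _ → 0) ≡ 0
∑-zero k = trans (∑≡sum {k} (λ _ → 0)) (ℕ-Sum.sum-replicate-zero k)

∑-distrib-+ : ∀ {k} (f g : Fin k → ℕ) → ∑ (λ i → f i + g i) ≡ ∑ f + ∑ g
∑-distrib-+ f g = begin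
  ∑ (λ i → f i + g i)          ≡⟨ ∑≡sum (λ i → f i + g i) ⟩
  ℕ-Sum.sum (λ i → f i + g i)  ≡⟨ ℕ-Sum.∑-distrib-+ f g ⟩
  ℕ-Sum.sum f + ℕ-Sum.sum g    ≡⟨ sym (cong₂ _+_ (∑≡sum f) (∑≡sum g)) ⟩
  ∑ f + ∑ g                    ∎
  where open ≡-Reasoning

∑-comm : ∀ {k l} (f : Fin k → Fin l → ℕ) →
         ∑ (λ i → ∑ (λ j → f i j)) ≡ ∑ (λ j → ∑ (λ i → f i j))
∑-comm f = begin
  ∑ (λ i → ∑ (λ j → f i j))                ≡⟨ ∑∑≡sumsum f ⟩
  ℕ-Sum.sum (λ i → ℕ-Sum.sum (λ j → f i j)) ≡⟨ ℕ-Sum.∑-comm f ⟩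
  ℕ-Sum.sum (λ j → ℕ-Sum.sum (λ i → f i j)) ≡⟨ sym (∑∑≡sumsum (λ j i → f i j)) ⟩
  ∑ (λ j → ∑ (λ i → f i j))                ∎
  where
  open ≡-Reasoning
  ∑∑≡sumsum : ∀ {k l} (g : Fin k → Fin l → ℕ) →
              ∑ (λ i → ∑ (g i)) ≡ ℕ-Sum.sum (λ i → ℕ-Sum.sum (g i))
  ∑∑≡sumsum g = trans (∑≡sum (λ i → ∑ (g i))) (ℕ-Sum.sum-cong-≗ (λ i → ∑≡sum (g i)))

∑-mono : ∀ {k} {f g : Fin k → ℕ} → (∀ i → f i ≤ g i) → ∑ f ≤ ∑ g
∑-mono {zero}  f≤g = z≤n
∑-mono {suc k} f≤g = +-mono-≤ (f≤g zero) (∑-mono (f≤g ∘ suc))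

term≤∑ : ∀ {k} (f : Fin k → ℕ) i → f i ≤ ∑ f
term≤∑ f zero    = m≤m+n _ _
term≤∑ f (suc i) = ≤-trans (term≤∑ (f ∘ suc) i) (m≤n+m _ _)

∑-mono-rigid : ∀ {k} (f g : Fin k → ℕ) → (∀ i → g i ≤ f i) → ∑ f ≤ ∑ g → f ≗ g
∑-mono-rigid f g g≤f ∑f≤∑g zero = ≤-antisym f₀≤g₀ (g≤f zero)
  where
  f₀≤g₀ : f zero ≤ g zero
  f₀≤g₀ = +-cancelʳ-≤ _ _ _ (≤-trans (+-monoʳ-≤ (f zero) (∑-mono (g≤f ∘ suc))) ∑f≤∑g)
∑-mono-rigid f g g≤f ∑f≤∑g (suc i) = ∑-mono-rigid (f ∘ suc) (g ∘ suc) (g≤f ∘ suc) ∑tail i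
  where
  ∑tail : ∑ (f ∘ suc) ≤ ∑ (g ∘ suc)
  ∑tail = +-cancelˡ-≤ (f zero) _ _ (≤-trans ∑f≤∑g (+-monoˡ-≤ _ (g≤f zero)))

∑-single : ∀ {k} (f : Fin k → ℕ) i → (∀ j → j ≢ i → f j ≡ 0) → ∑ f ≡ f i
∑-single {suc k} f zero others = begin
  f zero + ∑ (f ∘ suc) ≡⟨ cong (f zero +_) (trans (∑-cong (λ j → others (suc j) λ ())) (∑-zero k)) ⟩
  f zero + 0           ≡⟨ +-identityʳ _ ⟩
  f zero               ∎
  where open ≡-Reasoning
∑-single f (suc i) others =
  cong₂ _+_ (others zero λ ())
            (∑-single (f ∘ suc) i (λ j j≢i → others (suc j) (j≢i ∘ Fin.suc-injective)))

∑-↑ : ∀ k {l} (f : Fin (k + l) → ℕ) → ∑ f ≡ ∑ (λ i → f (i ↑ˡ l)) + ∑ (λ j → f (k ↑ʳ j))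
∑-↑ zero    f = refl
∑-↑ (suc k) f = trans (cong (f zero +_) (∑-↑ k (f ∘ suc))) (sym (+-assoc (f zero) _ _))

∑-combine : ∀ k {l} (f : Fin (k * l) → ℕ) → ∑ f ≡ ∑ {k} (λ i → ∑ {l} (λ j → f (combine i j)))
∑-combine zero    f = refl
∑-combine (suc k) {l} f =
  trans (∑-↑ l f) (cong (∑ (λ j → f (j ↑ˡ (k * l))) +_) (∑-combine k (λ i → f (l ↑ʳ i))))

count-const-true : ∀ k → count {k} (λ _ → true) ≡ k
count-const-true zero    = refl
count-const-true (suc k) = cong suc (count-const-true k)

count-+-count-not : ∀ {k} (p : Fin k → Bool) → count p + count (not ∘ p) ≡ k
count-+-count-not {k} p = begin
  count p + count (not ∘ p)        ≡⟨ sym (∑-distrib-+ (λ i → [ p i ]) (λ i → [ not (p i) ])) ⟩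
  ∑ (λ i → [ p i ] + [ not (p i) ]) ≡⟨ ∑-cong (λ i → [b]+[¬b]≡1 (p i)) ⟩
  count {k} (λ _ → true)            ≡⟨ count-const-true k ⟩
  k                                 ∎
  where
  open ≡-Reasoning
  [b]+[¬b]≡1 : ∀ b → [ b ] + [ not b ] ≡ 1
  [b]+[¬b]≡1 true  = refl
  [b]+[¬b]≡1 false = refl

count-<ᵇ : ∀ {k} l → l ≤ k → count {k} (λ j → toℕ j <ᵇ l) ≡ l
count-<ᵇ {zero}  zero    _         = refl
count-<ᵇ {suc k} zero    _         = ∑-zero (suc k)
count-<ᵇ {suc k} (suc l) (s≤s l≤k) = cong suc (count-<ᵇ l l≤k)

true⇒1≤count : ∀ {k} (p : Fin k → Bool) i → p i ≡ true → 1 ≤ count p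
true⇒1≤count p i pᵢ = subst (λ b → [ b ] ≤ count p) pᵢ (term≤∑ (λ j → [ p j ]) i)

two-trues : ∀ {k} (p : Fin (suc k) → Bool) {j} → p zero ≡ true → p (suc j) ≡ true → ¬ count p ≤ 1
two-trues p {j} p₀ pⱼ count≤1 with p zero
... | true with s≤s () ← ≤-trans (s≤s (true⇒1≤count (p ∘ suc) j pⱼ)) count≤1

count≤0⇒false : ∀ {k} (p : Fin k → Bool) → count p ≤ 0 → ∀ i → p i ≡ false
count≤0⇒false p count≤0 i with p i in pᵢ
... | false = refl
... | true with () ← ≤-trans (true⇒1≤count p i pᵢ) count≤0

count≤1⇒unique : ∀ {k} (p : Fin k → Bool) → count p ≤ 1 →
                 ∀ {i j} → p i ≡ true → p j ≡ true → i ≡ j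
count≤1⇒unique p _ {zero} {zero} _ _ = refl
count≤1⇒unique p count≤1 {zero} {suc j} p₀ pⱼ = ⊥-elim (two-trues p p₀ pⱼ count≤1)
count≤1⇒unique p count≤1 {suc i} {zero} pᵢ p₀ = ⊥-elim (two-trues p p₀ pᵢ count≤1)
count≤1⇒unique p count≤1 {suc i} {suc j} pᵢ pⱼ =
  cong suc (count≤1⇒unique (p ∘ suc) (≤-trans (m≤n+m _ _) count≤1) pᵢ pⱼ)

anyᵇ : ∀ {k} → (Fin k → Bool) → Bool
anyᵇ = foldr _∨_ false

anyᵇ-true : ∀ {k} (p : Fin k → Bool) i → p i ≡ true → anyᵇ p ≡ true
anyᵇ-true p zero    p₀ rewrite p₀ = refl
anyᵇ-true p (suc i) pᵢ rewrite anyᵇ-true (p ∘ suc) i pᵢ = ∨-zeroʳ (p zero)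

anyᵇ-false : ∀ {k} (p : Fin k → Bool) → (∀ i → p i ≡ false) → anyᵇ p ≡ false
anyᵇ-false {zero}  p _ = refl
anyᵇ-false {suc k} p allFalse rewrite allFalse zero = anyᵇ-false (p ∘ suc) (allFalse ∘ suc)

anyᵇ-count : ∀ {k} (p : Fin k → Bool) → count p ≤ 1 → [ anyᵇ p ] ≡ count p
anyᵇ-count {zero}  p _ = refl
anyᵇ-count {suc k} p count≤1 with p zero
... | true  = cong suc (sym (n≤0⇒n≡0 (≤-pred count≤1)))
... | false = anyᵇ-count (p ∘ suc) count≤1

count-∧-≤ : ∀ {k} (p q : Fin k → Bool) → count (λ i → p i ∧ q i) ≤ count p
count-∧-≤ p q = ∑-mono (λ i → ∧-≤ (p i) (q i))
  where
  ∧-≤ : ∀ a b → [ a ∧ b ] ≤ [ a ]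
  ∧-≤ true  true  = ≤-refl
  ∧-≤ true  false = z≤n
  ∧-≤ false _     = z≤n

anyᵇ-∧-unique : ∀ {k} (p q : Fin k → Bool) → count p ≤ 1 →
                ∀ {j} → p j ≡ true → anyᵇ (λ i → p i ∧ q i) ≡ q j
anyᵇ-∧-unique p q count≤1 {j} pⱼ with q j in qⱼ
... | true  = anyᵇ-true (λ i → p i ∧ q i) j (cong₂ _∧_ pⱼ qⱼ)
... | false = anyᵇ-false (λ i → p i ∧ q i) p∧q-false
  where
  p∧q-false : ∀ i → p i ∧ q i ≡ false
  p∧q-false i with p i in pᵢ
  ... | false = refl
  ... | true rewrite count≤1⇒unique p count≤1 pᵢ pⱼ = qⱼ

IsPermutationMatrix : ∀ {k} → (Fin k → Fin k → Bool) → Set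
IsPermutationMatrix P = (∀ i → count (P i) ≡ 1) × (∀ j → count (λ i → P i j) ≡ 1)

-- Double counting: ∑ rows = ∑ columns ≤ k ≤ ∑ rows, so every bound is tight.
rows≥1∧cols≤1⇒isPermutationMatrix :
  ∀ {k} (P : Fin k → Fin k → Bool) →
  (∀ i → 1 ≤ count (P i)) → (∀ j → count (λ i → P i j) ≤ 1) → IsPermutationMatrix P
rows≥1∧cols≤1⇒isPermutationMatrix P rows≥1 cols≤1 = rows≡1 , cols≡1
  where
  rows cols : Fin _ → ℕ
  rows i = count (P i)
  cols j = count (λ i → P i j)
  rows≡1 : ∀ i → rows i ≡ 1
  rows≡1 = ∑-mono-rigid rows (λ _ → 1) rows≥1
             (≤-trans (≤-reflexive (∑-comm (λ i j → [ P i j ]))) (∑-mono cols≤1))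
  cols≡1 : ∀ j → cols j ≡ 1
  cols≡1 j = sym (∑-mono-rigid (λ _ → 1) cols cols≤1
               (≤-trans (∑-mono rows≥1) (≤-reflexive (∑-comm (λ i j → [ P i j ])))) j)

-- anyᵇ (P i ∧ q) is q at the column picked by row i, and every column is picked once.
count-select : ∀ {k} (P : Fin k → Fin k → Bool) (q : Fin k → Bool) → IsPermutationMatrix P →
               count (λ i → anyᵇ (λ j → P i j ∧ q j)) ≡ count q
count-select {k} P q (rows≡1 , cols≡1) = begin
  ∑ (λ i → [ anyᵇ (λ j → P i j ∧ q j) ]) ≡⟨ ∑-cong (λ i → anyᵇ-count (λ j → P i j ∧ q j) (row∧q≤1 i)) ⟩
  ∑ (λ i → count (λ j → P i j ∧ q j))   ≡⟨ ∑-comm (λ i j → [ P i j ∧ q j ]) ⟩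
  ∑ (λ j → count (λ i → P i j ∧ q j))   ≡⟨ ∑-cong col∧q ⟩
  count q                               ∎
  where
  open ≡-Reasoning
  row∧q≤1 : ∀ i → count (λ j → P i j ∧ q j) ≤ 1
  row∧q≤1 i = ≤-trans (count-∧-≤ (P i) q) (≤-reflexive (rows≡1 i))
  col∧q : ∀ j → count (λ i → P i j ∧ q j) ≡ [ q j ]
  col∧q j with q j
  ... | true  = trans (∑-cong (λ i → cong [_] (∧-identityʳ (P i j)))) (cols≡1 j)
  ... | false = trans (∑-cong (λ i → cong [_] (∧-zeroʳ (P i j)))) (∑-zero k)

count-not : ∀ {k} (p : Fin k → Bool) {r} → count p + r ≡ k → count (not ∘ p) ≡ r
count-not p {r} p+r≡k = +-cancelˡ-≡ (count p) _ _ (trans (count-+-count-not p) (sym p+r≡k))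

data SplitView (k l : ℕ) : Fin (k + l) → Set where
  left  : ∀ i → SplitView k l (i ↑ˡ l)
  right : ∀ j → SplitView k l (k ↑ʳ j)

splitView : ∀ k {l} (u : Fin (k + l)) → SplitView k l u
splitView k u with splitAt k u in eq
... | inj₁ i = subst (SplitView k _) (Fin.splitAt⁻¹-↑ˡ eq) (left i)
... | inj₂ j = subst (SplitView k _) (Fin.splitAt⁻¹-↑ʳ eq) (right j)

data CombineView (k l : ℕ) : Fin (k * l) → Set where
  combined : ∀ i j → CombineView k l (combine {k} {l} i j)

combineView : ∀ k l (u : Fin (k * l)) → CombineView k l u
combineView k l u = subst (CombineView k l) (Fin.combine-remQuot {k} l u) (combined _ _)

outTerm : (G : Graph) → ArcVec G → VSet (Graph.n G) → Fin (Graph.m G) → ℕ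
outTerm G x U e =
    (if leavesᵇ U (arcTail G e true)  (arcHead G e true)  then x e true  else 0)
  + (if leavesᵇ U (arcTail G e false) (arcHead G e false) then x e false else 0)

DijoinPacking : (D : Digraph) → (Fin (Digraph.m D) → Bool) → (τ : ℕ) → Set
DijoinPacking D w τ =
  Σ (Fin τ → Fin (Digraph.m D) → Bool) λ J →
    (∀ i → IsDijoin D (J i)) × (∀ a → count (λ i → J i a) ≤ (if w a then 1 else 0))

DecomposesIntoSCOs : (G : Graph) (τ : ℕ) → ArcVec G → Set
DecomposesIntoSCOs G τ x =
  Σ (Fin τ → Orientation G) λ O →
    (∀ i → IsSCO G (O i)) × (∀ e d → x e d ≡ ∑ (λ i → χ G (O i) e d))

NoArcEnters : (D : Digraph) → VSet (Digraph.n D) → Set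
NoArcEnters D U = ∀ a → ¬ (leavesᵇ U (Digraph.head D a) (Digraph.tail D a) ≡ true)

module _ (G : Graph) where
  open Graph G

  InO-self : ∀ (o : Orientation G) e → InO G o e (o e) ≡ true
  InO-self o e with o e in oₑ
  ... | true  = oₑ
  ... | false = cong not oₑ

  leaves-from-either-end : ∀ (U : VSet n) e d →
                           (U (end₁ e) ∨ U (end₂ e)) ∧ not (U (arcHead G e d)) ≡ true →
                           leavesᵇ U (arcTail G e d) (arcHead G e d) ≡ true
  leaves-from-either-end U e true  with U (end₁ e) | U (end₂ e)
  ... | true  | false = λ _ → refl
  ... | true  | true  = λ ()
  ... | false | true  = λ ()
  ... | false | false = λ ()
  leaves-from-either-end U e false with U (end₁ e) | U (end₂ e)
  ... | false | true  = λ _ → refl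
  ... | false | false = λ ()
  ... | true  | _     = λ ()

  head-in⇒end-in : ∀ (U : VSet n) e d → U (arcHead G e d) ≡ true → U (end₁ e) ∨ U (end₂ e) ≡ true
  head-in⇒end-in U e true  h∈U rewrite h∈U = ∨-zeroʳ (U (end₁ e))
  head-in⇒end-in U e false h∈U rewrite h∈U = refl

  head-outside⁺ : ∀ (U : VSet n) e → U (end₁ e) ≡ true → U (end₂ e) ≡ false →
                  ∀ d → not (U (arcHead G e d)) ≡ d
  head-outside⁺ U e u₁ u₂ true  rewrite u₂ = refl
  head-outside⁺ U e u₁ u₂ false rewrite u₁ = refl

  head-outside⁻ : ∀ (U : VSet n) e → U (end₁ e) ≡ false → U (end₂ e) ≡ true →
                  ∀ d → not (U (arcHead G e d)) ≡ not d
  head-outside⁻ U e u₁ u₂ true  rewrite u₂ = refl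
  head-outside⁻ U e u₁ u₂ false rewrite u₁ = refl

module Doubling (D : Digraph) (w : Fin (Digraph.m D) → Bool) (t : ℕ) where
  open Digraph D

  τ : ℕ
  τ = suc t

  arcOf : Fin (m + m) → Fin m
  arcOf e = [ id , id ]′ (splitAt m e)

  arcOf-↑ˡ : ∀ a → arcOf (a ↑ˡ m) ≡ a
  arcOf-↑ˡ a rewrite Fin.splitAt-↑ˡ m a m = refl

  arcOf-↑ʳ : ∀ a → arcOf (m ↑ʳ a) ≡ a
  arcOf-↑ʳ a rewrite Fin.splitAt-↑ʳ m m a = refl

  G : Graph
  G = record { n = n ; m = m + m ; end₁ = tail ∘ arcOf ; end₂ = head ∘ arcOf }

  weightedCopy : Fin m → Bool → ℕ
  weightedCopy a true  = [ w a ]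
  weightedCopy a false = if w a then t else τ

  reversedCopy : Bool → ℕ
  reversedCopy true  = 0
  reversedCopy false = τ

  x : ArcVec G
  x e d = [ (λ a → weightedCopy a d) , (λ _ → reversedCopy d) ]′ (splitAt m e)

  x-↑ˡ : ∀ a d → x (a ↑ˡ m) d ≡ weightedCopy a d
  x-↑ˡ a d rewrite Fin.splitAt-↑ˡ m a m = refl

  x-↑ʳ : ∀ a d → x (m ↑ʳ a) d ≡ reversedCopy d
  x-↑ʳ a d rewrite Fin.splitAt-↑ʳ m m a = refl

  x-total : ∀ e → x e true + x e false ≡ τ
  x-total e with splitAt m e
  ... | inj₂ _ = refl
  ... | inj₁ a with w a
  ...   | true  = refl
  ...   | false = refl

  outTerm-↑ˡ : ∀ U a → outTerm G x U (a ↑ˡ m) ≡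
    (if leavesᵇ U (tail a) (head a) then [ w a ] else 0) +
    (if leavesᵇ U (head a) (tail a) then weightedCopy a false else 0)
  outTerm-↑ˡ U a rewrite arcOf-↑ˡ a | x-↑ˡ a true | x-↑ˡ a false = refl

  outTerm-↑ʳ : ∀ U a → outTerm G x U (m ↑ʳ a) ≡ (if leavesᵇ U (head a) (tail a) then τ else 0)
  outTerm-↑ʳ U a rewrite arcOf-↑ʳ a | x-↑ʳ a true | x-↑ʳ a false with leavesᵇ U (tail a) (head a)
  ... | true  = refl
  ... | false = refl

  reversedCopy-out : ∀ U a → leavesᵇ U (head a) (tail a) ≡ true → τ ≤ outTerm G x U (m ↑ʳ a)
  reversedCopy-out U a a-enters rewrite outTerm-↑ʳ U a | a-enters = ≤-refl

  weightedCopy-out : ∀ U a → [ leavesᵇ U (tail a) (head a) ∧ w a ] ≤ outTerm G x U (a ↑ˡ m)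
  weightedCopy-out U a rewrite outTerm-↑ˡ U a with leavesᵇ U (tail a) (head a)
  ... | false = z≤n
  ... | true with w a
  ...   | true  = s≤s z≤n
  ...   | false = z≤n

  x-out : MinDicutWeight D w τ → ∀ U → NonemptyProper U → τ ≤ outSum G x U
  x-out (dicut≥τ , _) U U-proper
    with Fin.any? (λ a → leavesᵇ U (head a) (tail a) ≟ᵇ true)
  ... | yes (a , a-enters) = begin
    τ                                   ≤⟨ reversedCopy-out U a a-enters ⟩
    outTerm G x U (m ↑ʳ a)              ≤⟨ term≤∑ (λ a → outTerm G x U (m ↑ʳ a)) a ⟩
    ∑ (λ a → outTerm G x U (m ↑ʳ a))    ≤⟨ m≤n+m _ _ ⟩
    ∑ (λ a → outTerm G x U (a ↑ˡ m)) + ∑ (λ a → outTerm G x U (m ↑ʳ a)) ≡⟨ ∑-↑ m (outTerm G x U) ⟨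
    outSum G x U                        ∎
    where open ≤-Reasoning
  ... | no no-entry = begin
    τ                                   ≤⟨ dicut≥τ U (U-proper , λ a a-enters → no-entry (a , a-enters)) ⟩
    dicutWeight D w U                   ≤⟨ ∑-mono (weightedCopy-out U) ⟩
    ∑ (λ a → outTerm G x U (a ↑ˡ m))    ≤⟨ m≤m+n _ _ ⟩
    ∑ (λ a → outTerm G x U (a ↑ˡ m)) + ∑ (λ a → outTerm G x U (m ↑ʳ a)) ≡⟨ ∑-↑ m (outTerm G x U) ⟨
    outSum G x U                        ∎
    where open ≤-Reasoning

  x-isτSCO : MinDicutWeight D w τ → IsτSCO G τ x
  x-isτSCO md = x-total , x-out md

  copyLeaves : VSet n → Fin m → Bool → Bool
  copyLeaves U a true  = leavesᵇ U (tail a) (head a)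
  copyLeaves U a false = leavesᵇ U (head a) (tail a)

  leaves-↑ˡ : ∀ U a d → leavesᵇ U (arcTail G (a ↑ˡ m) d) (arcHead G (a ↑ˡ m) d) ≡ copyLeaves U a d
  leaves-↑ˡ U a true  rewrite arcOf-↑ˡ a = refl
  leaves-↑ˡ U a false rewrite arcOf-↑ˡ a = refl

  leaves-↑ʳ : ∀ U a d → leavesᵇ U (arcTail G (m ↑ʳ a) d) (arcHead G (m ↑ʳ a) d) ≡ copyLeaves U a d
  leaves-↑ʳ U a true  rewrite arcOf-↑ʳ a = refl
  leaves-↑ʳ U a false rewrite arcOf-↑ʳ a = refl

  module FromDecomposition
    (O : Fin τ → Orientation G) (O-sco : ∀ i → IsSCO G (O i))
    (x≡∑χ : ∀ e d → x e d ≡ ∑ (λ i → χ G (O i) e d)) where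

    J : Fin τ → Fin m → Bool
    J i a = w a ∧ O i (a ↑ˡ m)

    x≡0⇒unused : ∀ e d → x e d ≡ 0 → ∀ i → InO G (O i) e d ≡ false
    x≡0⇒unused e d x≡0 =
      count≤0⇒false (λ i → InO G (O i) e d) (≤-reflexive (trans (sym (x≡∑χ e d)) x≡0))

    J-count : ∀ a → count (λ i → J i a) ≤ [ w a ]
    J-count a with w a in wₐ
    ... | false = ≤-reflexive (∑-zero τ)
    ... | true  = ≤-reflexive (trans (sym (x≡∑χ (a ↑ˡ m) true)) (trans (x-↑ˡ a true) (cong [_] wₐ)))

    dicut-crossing : ∀ i U → NoArcEnters D U →
                     ∀ e d → InO G (O i) e d ≡ true → leavesᵇ U (arcTail G e d) (arcHead G e d) ≡ true →
                     ∃[ a ] (Leaves D U a × J i a ≡ true)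
    dicut-crossing i U no-entry e d e∈Oᵢ e-leaves with splitView m e | d
    ... | left a | true with w a in wₐ
    ...   | true  = a , trans (sym (leaves-↑ˡ U a true)) e-leaves , trans (cong (_∧ O i (a ↑ˡ m)) wₐ) e∈Oᵢ
    ...   | false with () ← trans (sym e∈Oᵢ)
                         (x≡0⇒unused (a ↑ˡ m) true (trans (x-↑ˡ a true) (cong [_] wₐ)) i)
    dicut-crossing i U no-entry e d e∈Oᵢ e-leaves | left a | false =
      ⊥-elim (no-entry a (trans (sym (leaves-↑ˡ U a false)) e-leaves))
    dicut-crossing i U no-entry e d e∈Oᵢ e-leaves | right a | true
      with () ← trans (sym e∈Oᵢ) (x≡0⇒unused (m ↑ʳ a) true (x-↑ʳ a true) i)
    dicut-crossing i U no-entry e d e∈Oᵢ e-leaves | right a | false =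
      ⊥-elim (no-entry a (trans (sym (leaves-↑ʳ U a false)) e-leaves))

    J-dijoin : ∀ i → IsDijoin D (J i)
    J-dijoin i U (U-proper , no-entry) with O-sco i U U-proper
    ... | e , d , e∈Oᵢ , e-leaves = dicut-crossing i U no-entry e d e∈Oᵢ e-leaves

  packing : SCODecomposition → MinDicutWeight D w τ → DijoinPacking D w τ
  packing decompose md with decompose G τ (s≤s z≤n) x (x-isτSCO md)
  ... | O , O-sco , x≡∑χ = J , J-dijoin , J-count
    where open FromDecomposition O O-sco x≡∑χ

SCODecomposition⇒EdmondsGiles : SCODecomposition → EdmondsGiles
SCODecomposition⇒EdmondsGiles decompose D w zero    _  = (λ ()) , (λ ()) , (λ _ → z≤n)
SCODecomposition⇒EdmondsGiles decompose D w (suc t) md = Doubling.packing D w t decompose md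

module Gadget (G : Graph) (τ : ℕ) (x : ArcVec G) where
  open Graph G

  vertex : Fin n → Fin (n + m)
  vertex v = v ↑ˡ m

  node : Fin m → Fin (n + m)
  node e = n ↑ʳ e

  forward : Fin m → Fin τ → Bool
  forward e j = toℕ j <ᵇ x e true

  target : Fin m → Fin τ → Fin n
  target e j = arcHead G e (forward e j)

  arcEnd : Fin m → Fin (2 + τ) → Fin n
  arcEnd e zero          = end₁ e
  arcEnd e (suc zero)    = end₂ e
  arcEnd e (suc (suc j)) = target e j

  unitWeight : Fin (2 + τ) → Bool
  unitWeight zero          = false
  unitWeight (suc zero)    = false
  unitWeight (suc (suc j)) = true

  arc : Fin m → Fin (2 + τ) → Fin (m * (2 + τ))
  arc = combine

  arcOf : Fin (m * (2 + τ)) → Fin m × Fin (2 + τ)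
  arcOf = remQuot (2 + τ)

  D : Digraph
  D = record { n = n + m ; m = m * (2 + τ)
             ; tail = node ∘ proj₁ ∘ arcOf ; head = vertex ∘ uncurry arcEnd ∘ arcOf }

  w : Fin (m * (2 + τ)) → Bool
  w = unitWeight ∘ proj₂ ∘ arcOf

  open Digraph D using (tail; head)

  tail-arc : ∀ e j → tail (arc e j) ≡ node e
  tail-arc e j = cong (node ∘ proj₁) (Fin.remQuot-combine e j)

  head-arc : ∀ e j → head (arc e j) ≡ vertex (arcEnd e j)
  head-arc e j = cong (vertex ∘ uncurry arcEnd) (Fin.remQuot-combine e j)

  w-arc : ∀ e j → w (arc e j) ≡ unitWeight j
  w-arc e j = cong (unitWeight ∘ proj₂) (Fin.remQuot-combine e j)

  leaves-arc : ∀ U e j → leavesᵇ U (tail (arc e j)) (head (arc e j))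
                           ≡ leavesᵇ U (node e) (vertex (arcEnd e j))
  leaves-arc U e j = cong₂ (leavesᵇ U) (tail-arc e j) (head-arc e j)

  enters-arc : ∀ U e j → leavesᵇ U (head (arc e j)) (tail (arc e j))
                           ≡ leavesᵇ U (vertex (arcEnd e j)) (node e)
  enters-arc U e j = cong₂ (leavesᵇ U) (head-arc e j) (tail-arc e j)

  load : VSet (n + m) → Fin m → ℕ
  load U e = count (λ j → leavesᵇ U (node e) (vertex (target e j)))

  dicutWeight≡∑load : ∀ U → dicutWeight D w U ≡ ∑ (load U)
  dicutWeight≡∑load U = begin
    dicutWeight D w U
      ≡⟨ ∑-combine m {2 + τ} (λ a → [ leavesᵇ U (tail a) (head a) ∧ w a ]) ⟩
    ∑ (λ (e : Fin m) → ∑ (λ (j : Fin (2 + τ)) → [ leavesᵇ U (tail (arc e j)) (head (arc e j))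
                        ∧ w (arc e j) ]))
      ≡⟨ ∑-cong (λ e → ∑-cong (λ j → cong [_] (cong₂ _∧_ (leaves-arc U e j) (w-arc e j)))) ⟩
    ∑ (λ (e : Fin m) → ∑ (λ j → [ leavesᵇ U (node e) (vertex (arcEnd e j)) ∧ unitWeight j ]))
      ≡⟨ ∑-cong unit-arcs ⟩
    ∑ (load U) ∎
    where
    open ≡-Reasoning
    unit-arcs : ∀ e → ∑ (λ j → [ leavesᵇ U (node e) (vertex (arcEnd e j)) ∧ unitWeight j ]) ≡ load U e
    unit-arcs e = cong₂ _+_ (cong [_] (∧-zeroʳ (leavesᵇ U (node e) (vertex (end₁ e)))))
                    (cong₂ _+_ (cong [_] (∧-zeroʳ (leavesᵇ U (node e) (vertex (end₂ e)))))
                      (∑-cong (λ j → cong [_] (∧-identityʳ (leavesᵇ U (node e) (vertex (target e j)))))))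

  end-in⇒node-in : ∀ U → NoArcEnters D U → ∀ e j → U (vertex (arcEnd e j)) ≡ true → U (node e) ≡ true
  end-in⇒node-in U no-entry e j end∈U with U (node e) in node∈U
  ... | true  = refl
  ... | false = ⊥-elim (no-entry (arc e j)
                  (trans (enters-arc U e j) (cong₂ _∧_ end∈U (cong not node∈U))))

  load-node-in : ∀ U e → U (node e) ≡ true → load U e ≡ count (λ j → not (U (vertex (target e j))))
  load-node-in U e node∈U = ∑-cong (λ j → cong (λ b → [ b ∧ not (U (vertex (target e j))) ]) node∈U)

  load-node-out : ∀ U e → U (node e) ≡ false → load U e ≡ 0
  load-node-out U e node∉U =
    trans (∑-cong (λ j → cong (λ b → [ b ∧ not (U (vertex (target e j))) ]) node∉U)) (∑-zero τ)

  load-targets-out : ∀ U e → U (node e) ≡ true → (∀ j → U (vertex (target e j)) ≡ false) → load U e ≡ τ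
  load-targets-out U e node∈U targets∉U =
    trans (load-node-in U e node∈U)
          (trans (∑-cong (λ j → cong (λ b → [ not b ]) (targets∉U j))) (count-const-true τ))

  singleton : Fin m → VSet (n + m)
  singleton e = [ (λ _ → false) , (λ e' → does (e' Fin.≟ e)) ]′ ∘ splitAt n

  singleton-vertex : ∀ e v → singleton e (vertex v) ≡ false
  singleton-vertex e v rewrite Fin.splitAt-↑ˡ n v m = refl

  singleton-node : ∀ e e' → singleton e (node e') ≡ does (e' Fin.≟ e)
  singleton-node e e' rewrite Fin.splitAt-↑ʳ n m e' = refl

  singleton-isDicut : ∀ e → IsDicut D (singleton e)
  singleton-isDicut e =
    ((node e , trans (singleton-node e e) (dec-true (e Fin.≟ e) refl)) ,
     (vertex (end₁ e) , singleton-vertex e (end₁ e))) ,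
    λ a → no-entry (combineView m (2 + τ) a)
    where
    no-entry : ∀ {a} → CombineView m (2 + τ) a →
               ¬ (leavesᵇ (singleton e) (head a) (tail a) ≡ true)
    no-entry (combined e' j) a-enters
      rewrite enters-arc (singleton e) e' j | singleton-vertex e (arcEnd e' j) with () ← a-enters

  singleton-leaves : ∀ e e' j → leavesᵇ (singleton e) (tail (arc e' j)) (head (arc e' j)) ≡ true → e' ≡ e
  singleton-leaves e e' j arc-leaves = ≟⇒≡ e' e (trans (sym (singleton-node e e'))
    (∧≡true⇒ˡ (singleton e (node e')) (trans (sym (leaves-arc (singleton e) e' j)) arc-leaves)))

  singleton-weight : ∀ e → dicutWeight D w (singleton e) ≡ τ
  singleton-weight e = begin
    dicutWeight D w (singleton e) ≡⟨ dicutWeight≡∑load (singleton e) ⟩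
    ∑ (load (singleton e))        ≡⟨ ∑-single (load (singleton e)) e other-loads ⟩
    load (singleton e) e          ≡⟨ load-targets-out (singleton e) e
                                      (trans (singleton-node e e) (dec-true (e Fin.≟ e) refl))
                                      (λ j → singleton-vertex e (target e j)) ⟩
    τ                             ∎
    where
    open ≡-Reasoning
    other-loads : ∀ e' → e' ≢ e → load (singleton e) e' ≡ 0
    other-loads e' e'≢e =
      load-node-out (singleton e) e' (trans (singleton-node e e') (dec-false (e' Fin.≟ e) e'≢e))

  arcEnd-in⇒end-in : ∀ (U : VSet n) e j → U (arcEnd e j) ≡ true → U (end₁ e) ∨ U (end₂ e) ≡ true
  arcEnd-in⇒end-in U e zero          h∈U = head-in⇒end-in G U e false h∈U
  arcEnd-in⇒end-in U e (suc zero)    h∈U = head-in⇒end-in G U e true h∈U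
  arcEnd-in⇒end-in U e (suc (suc j)) h∈U = head-in⇒end-in G U e (forward e j) h∈U

  closure : VSet n → VSet (n + m)
  closure U = [ U , (λ e → U (end₁ e) ∨ U (end₂ e)) ]′ ∘ splitAt n

  closure-vertex : ∀ (U : VSet n) v → closure U (vertex v) ≡ U v
  closure-vertex U v rewrite Fin.splitAt-↑ˡ n v m = refl

  closure-node : ∀ (U : VSet n) e → closure U (node e) ≡ U (end₁ e) ∨ U (end₂ e)
  closure-node U e rewrite Fin.splitAt-↑ʳ n m e = refl

  closure-leaves : ∀ U e j → leavesᵇ (closure U) (tail (arc e j)) (head (arc e j))
                             ≡ (U (end₁ e) ∨ U (end₂ e)) ∧ not (U (arcEnd e j))
  closure-leaves U e j =
    trans (leaves-arc (closure U) e j) (cong₂ (λ a b → a ∧ not b) (closure-node U e) (closure-vertex U (arcEnd e j)))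

  closure-enters : ∀ U e j → leavesᵇ (closure U) (head (arc e j)) (tail (arc e j))
                             ≡ U (arcEnd e j) ∧ not (U (end₁ e) ∨ U (end₂ e))
  closure-enters U e j =
    trans (enters-arc (closure U) e j) (cong₂ (λ a b → a ∧ not b) (closure-vertex U (arcEnd e j)) (closure-node U e))

  arc-into-closure : ∀ (U : VSet n) e j → ¬ (U (arcEnd e j) ∧ not (U (end₁ e) ∨ U (end₂ e)) ≡ true)
  arc-into-closure U e j enters with U (arcEnd e j) in h∈U | U (end₁ e) ∨ U (end₂ e) in ends
  ... | false | _     with () ← enters
  ... | true  | true  with () ← enters
  ... | true  | false with () ← trans (sym (arcEnd-in⇒end-in U e j h∈U)) ends

  closure-isDicut : ∀ (U : VSet n) → NonemptyProper U → IsDicut D (closure U)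
  closure-isDicut U ((v , v∈U) , (v' , v'∉U)) =
    ((vertex v , trans (closure-vertex U v) v∈U) , (vertex v' , trans (closure-vertex U v') v'∉U)) ,
    λ a → no-entry (combineView m (2 + τ) a)
    where
    no-entry : ∀ {a} → CombineView m (2 + τ) a →
               ¬ (leavesᵇ (closure U) (head a) (tail a) ≡ true)
    no-entry (combined e j) a-enters = arc-into-closure U e j (trans (sym (closure-enters U e j)) a-enters)

  restrict : VSet (n + m) → VSet n
  restrict U = U ∘ vertex

  module _ (x-total : ∀ e → x e true + x e false ≡ τ) where

    x⁺≤τ : ∀ e → x e true ≤ τ
    x⁺≤τ e = m+n≤o⇒m≤o (x e true) (≤-reflexive (x-total e))

    load⁺ : ∀ U → NoArcEnters D U → ∀ e → restrict U (end₁ e) ≡ true → restrict U (end₂ e) ≡ false →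
            load U e ≡ x e true
    load⁺ U no-entry e u₁ u₂ = begin
      load U e                                    ≡⟨ load-node-in U e (end-in⇒node-in U no-entry e zero u₁) ⟩
      count (λ j → not (U (vertex (target e j)))) ≡⟨ ∑-cong (cong [_] ∘ target-outside) ⟩
      count (forward e)                           ≡⟨ count-<ᵇ (x e true) (x⁺≤τ e) ⟩
      x e true                                    ∎
      where
      open ≡-Reasoning
      target-outside : ∀ j → not (U (vertex (target e j))) ≡ forward e j
      target-outside j = head-outside⁺ G (restrict U) e u₁ u₂ (forward e j)

    load⁻ : ∀ U → NoArcEnters D U → ∀ e → restrict U (end₁ e) ≡ false → restrict U (end₂ e) ≡ true →
            load U e ≡ x e false
    load⁻ U no-entry e u₁ u₂ = begin
      load U e                                    ≡⟨ load-node-in U e (end-in⇒node-in U no-entry e (suc zero) u₂) ⟩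
      count (λ j → not (U (vertex (target e j)))) ≡⟨ ∑-cong (cong [_] ∘ target-outside) ⟩
      count (not ∘ forward e)                     ≡⟨ count-not (forward e) forward+backward≡τ ⟩
      x e false                                   ∎
      where
      open ≡-Reasoning
      target-outside : ∀ j → not (U (vertex (target e j))) ≡ not (forward e j)
      target-outside j = head-outside⁻ G (restrict U) e u₁ u₂ (forward e j)
      forward+backward≡τ : count (forward e) + x e false ≡ τ
      forward+backward≡τ = trans (cong (_+ x e false) (count-<ᵇ (x e true) (x⁺≤τ e))) (x-total e)

    outTerm≤load : ∀ U → NoArcEnters D U → ∀ e → outTerm G x (restrict U) e ≤ load U e
    outTerm≤load U no-entry e with restrict U (end₁ e) in u₁ | restrict U (end₂ e) in u₂
    ... | true  | true  = z≤n
    ... | false | false = z≤n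
    ... | true  | false = ≤-reflexive (trans (+-identityʳ _) (sym (load⁺ U no-entry e u₁ u₂)))
    ... | false | true  = ≤-reflexive (sym (load⁻ U no-entry e u₁ u₂))

    module _ (x-out : ∀ U → NonemptyProper U → τ ≤ outSum G x U) where

      -- If U contains some but not all vertices, loads dominate x(δ⁺(U ∩ V)); if it contains
      -- no vertex, it contains a node whose whole star leaves it; V ⊆ U puts every node in U.
      dicut≥τ : ∀ U → IsDicut D U → τ ≤ dicutWeight D w U
      dicut≥τ U (((u , u∈U) , (u' , u'∉U)) , no-entry) =
        subst (τ ≤_) (sym (dicutWeight≡∑load U)) τ≤∑load
        where
        τ≤∑load : τ ≤ ∑ (load U)
        τ≤∑load with Fin.any? (λ v → restrict U v ≟ᵇ true) | Fin.any? (λ v → restrict U v ≟ᵇ false)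
        ... | yes some-in | yes some-out =
          ≤-trans (x-out (restrict U) (some-in , some-out)) (∑-mono (outTerm≤load U no-entry))
        ... | no none-in | _ = node-alone (splitView n u) u∈U
          where
          node-alone : ∀ {u} → SplitView n m u → U u ≡ true → τ ≤ ∑ (load U)
          node-alone (left v)  v∈U  = ⊥-elim (none-in (v , v∈U))
          node-alone (right e) e∈U  =
            ≤-trans (≤-reflexive (sym (load-targets-out U e e∈U (λ j → ¬-not (λ t∈U → none-in (_ , t∈U))))))
                    (term≤∑ (load U) e)
        ... | yes _ | no none-out = ⊥-elim (node-outside (splitView n u') u'∉U)
          where
          node-outside : ∀ {u} → SplitView n m u → ¬ (U u ≡ false)
          node-outside (left v)  v∉U = none-out (v , v∉U)
          node-outside (right e) e∉U with restrict U (end₁ e) in u₁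
          ... | true  with () ← trans (sym e∉U) (end-in⇒node-in U no-entry e zero u₁)
          ... | false = none-out (end₁ e , u₁)

      minDicutWeight : Fin m → MinDicutWeight D w τ
      minDicutWeight e = dicut≥τ , singleton e , singleton-isDicut e , singleton-weight e

    module FromDijoins
      (J : Fin τ → Fin (m * (2 + τ)) → Bool) (J-dijoin : ∀ i → IsDijoin D (J i))
      (J-count : ∀ a → count (λ i → J i a) ≤ [ w a ]) where

      J-weighted : ∀ i a → J i a ≡ true → w a ≡ true
      J-weighted i a a∈Jᵢ with w a in wₐ
      ... | true  = refl
      ... | false with () ← trans (sym a∈Jᵢ)
            (count≤0⇒false (λ i → J i a) (subst (λ b → count (λ i → J i a) ≤ [ b ]) wₐ (J-count a)) i)

      unitWeight-arc : ∀ i e j → J i (arc e j) ≡ true → unitWeight j ≡ true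
      unitWeight-arc i e j a∈Jᵢ = trans (sym (w-arc e j)) (J-weighted i _ a∈Jᵢ)

      picks : Fin m → Fin τ → Fin τ → Bool
      picks e i j = J i (arc e (suc (suc j)))

      picks-columns : ∀ e j → count (λ i → picks e i j) ≤ 1
      picks-columns e j = subst (λ b → count (λ i → picks e i j) ≤ [ b ]) (w-arc e (suc (suc j)))
                            (J-count (arc e (suc (suc j))))

      picks-rows : ∀ e i → 1 ≤ count (picks e i)
      picks-rows e i with J-dijoin i (singleton e) (singleton-isDicut e)
      ... | a , a-leaves , a∈Jᵢ = meets (combineView m (2 + τ) a) a-leaves a∈Jᵢ
        where
        meets : ∀ {a} → CombineView m (2 + τ) a → Leaves D (singleton e) a → J i a ≡ true →
                1 ≤ count (picks e i)
        meets (combined e' zero)          _        a∈Jᵢ with () ← unitWeight-arc i e' zero a∈Jᵢ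
        meets (combined e' (suc zero))    _        a∈Jᵢ with () ← unitWeight-arc i e' (suc zero) a∈Jᵢ
        meets (combined e' (suc (suc j))) a-leaves a∈Jᵢ with singleton-leaves e e' (suc (suc j)) a-leaves
        ... | refl = true⇒1≤count (picks e i) j a∈Jᵢ

      picks-permutation : ∀ e → IsPermutationMatrix (picks e)
      picks-permutation e = rows≥1∧cols≤1⇒isPermutationMatrix (picks e) (picks-rows e) (picks-columns e)

      -- O i orients e towards the head of the unit arc at e picked by J i.
      O : Fin τ → Orientation G
      O i e = anyᵇ (λ j → picks e i j ∧ (forward e j))

      O-count : ∀ e → count (λ i → O i e) ≡ x e true
      O-count e = trans (count-select (picks e) (forward e) (picks-permutation e))
                        (count-<ᵇ (x e true) (x⁺≤τ e))

      x≡∑χ : ∀ e d → x e d ≡ ∑ (λ i → χ G (O i) e d)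
      x≡∑χ e true  = sym (O-count e)
      x≡∑χ e false = sym (count-not (λ i → O i e) (trans (cong (_+ x e false) (O-count e)) (x-total e)))

      O-follows-pick : ∀ i e j → picks e i j ≡ true → O i e ≡ (forward e j)
      O-follows-pick i e j =
        anyᵇ-∧-unique (picks e i) (forward e) (≤-reflexive (proj₁ (picks-permutation e) i))

      O-sco : ∀ i → IsSCO G (O i)
      O-sco i U U-proper with J-dijoin i (closure U) (closure-isDicut U U-proper)
      ... | a , a-leaves , a∈Jᵢ = crossing (combineView m (2 + τ) a) a-leaves a∈Jᵢ
        where
        crossing : ∀ {a} → CombineView m (2 + τ) a → Leaves D (closure U) a → J i a ≡ true →
                   ∃[ e ] ∃[ d ] (InO G (O i) e d ≡ true × leavesᵇ U (arcTail G e d) (arcHead G e d) ≡ true)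
        crossing (combined e zero)          _        a∈Jᵢ with () ← unitWeight-arc i e zero a∈Jᵢ
        crossing (combined e (suc zero))    _        a∈Jᵢ with () ← unitWeight-arc i e (suc zero) a∈Jᵢ
        crossing (combined e (suc (suc j))) a-leaves a∈Jᵢ =
          e , O i e , InO-self G (O i) e , leaves-from-either-end G U e (O i e)
            (subst (λ d → (U (end₁ e) ∨ U (end₂ e)) ∧ not (U (arcHead G e d)) ≡ true)
                   (sym (O-follows-pick i e j a∈Jᵢ)) leaves)
          where
          leaves : (U (end₁ e) ∨ U (end₂ e)) ∧ not (U (target e j)) ≡ true
          leaves = trans (sym (closure-leaves U e (suc (suc j)))) a-leaves


  decomposition : EdmondsGiles → Fin m → IsτSCO G τ x → DecomposesIntoSCOs G τ x
  decomposition eg e (x-total , x-out) with eg D w τ (minDicutWeight x-total x-out e)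
  ... | J , J-dijoin , J-count = O , O-sco , x≡∑χ
    where open FromDijoins x-total J J-dijoin J-count

EdmondsGiles⇒SCODecomposition : EdmondsGiles → SCODecomposition
EdmondsGiles⇒SCODecomposition eg G zero () x
EdmondsGiles⇒SCODecomposition eg G@record { m = suc _ } τ@(suc _) _ x x-τSCO =
  Gadget.decomposition G τ x eg zero x-τSCO
-- Without edges no dicut of the gadget has weight τ, but then no U is nonempty and proper.
EdmondsGiles⇒SCODecomposition eg record { m = zero } (suc t) _ x (_ , x-out) =
  (λ _ ()) , (λ i U U-proper → ⊥-elim (no-edges (x-out U U-proper))) , (λ ())
  where
  no-edges : ¬ (suc t ≤ 0)
  no-edges ()

theorem10 : EdmondsGiles ⇔ SCODecomposition
theorem10 = mk⇔ EdmondsGiles⇒SCODecomposition SCODecomposition⇒EdmondsGiles
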